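{- For every $n\ge1$ there exists a non-adaptive set $\mathcal{Q}$ of $n+1$ query sequences, each of length at most $n$ and over the alphabet $\{0,1,2\}$ where $2$ is an extra character not in $\{0,1\}$, and an algorithm that, for any input sequence $s\in\{0,1\}^{\ell}$ with $0\le\ell\le n$, exactly recovers $s$ from the Levenshtein distances $d_L(s,q)$, $q\in\mathcal{Q}$.
   Context: The Levenshtein (edit) distance $d_L(x,y)$ is the minimal number of single-symbol insertions, deletions and substitutions transforming $x$ into $y$ (symbols may be arbitrary, costs do not depend on which symbols are involved). Non-adaptive means the query set is fixed in advance independently of $s$; the length of $s$ is unknown. -}

module Defs where

open import Data.Nat using (ℕ; zero; suc; _≤_)
open import Data.List using (List; []; _∷_; _++_; map)
open import Data.Bool using (Bool; true; false)
open import Data.Fin using (Fin; zero; suc)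
open import Data.Product using (_×_)

data Step {A : Set} : List A → List A → Set where
  ins : (u v : List A) (a : A) → Step (u ++ v) (u ++ (a ∷ v))
  del : (u v : List A) (a : A) → Step (u ++ (a ∷ v)) (u ++ v)
  sub : (u v : List A) (a b : A) → Step (u ++ (a ∷ v)) (u ++ (b ∷ v))

data EditsIn {A : Set} : ℕ → List A → List A → Set where
  none : (x : List A) → EditsIn zero x x
  step : {k : ℕ} {x y z : List A} → Step x y → EditsIn k y z → EditsIn (suc k) x z

IsLevDist : {A : Set} → List A → List A → ℕ → Set
IsLevDist x y d = EditsIn d x y × ((k : ℕ) → EditsIn k x y → d ≤ k)

-- Alphabet {0,1,2} = Fin 3; binary symbols 0,1 embed as 0,1; 2 is the extra symbol.
bit : Bool → Fin 3
bit false = zero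
bit true  = suc zero

embed : List Bool → List (Fin 3)
embed = map bit

{-# OPTIONS --safe #-}
-- Query j (1 ≤ j ≤ n) is 0ʲ2ⁿ⁻ʲ and query 0 is the empty word, at distance |s|.
-- For j ≤ |s| the distance from s to query j is (number of 1s among the first j
-- symbols of s) + (n − j).  Turning those 1s into 0s and the remaining symbols
-- into 2s, then inserting 2s, attains this value.  Conversely the potential
-- Φⱼ x = (1s among the first j symbols of x) − (2s after them) changes by at most
-- one per edit, and it goes from the count of 1s in s (which has no 2s) to
-- −(n − j).  The distances thus determine every prefix count of 1s in s, hence s.
module Submission where

open import Defs
open import Data.Nat using (ℕ; zero; suc; _≤_; _<_; _+_; _∸_; z≤n; s≤s; _<?_)
open import Data.Nat.Properties
open import Algebra.Properties.CommutativeSemigroup +-commutativeSemigroup using (x∙yz≈y∙xz)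
open import Data.Nat.Tactic.RingSolver using (solve-∀)
open import Data.List using (List; []; _∷_; _++_; length; replicate; map; take; drop)
open import Data.Nat.ListAction using (sum)
open import Data.List.Properties using (length-++; length-++-sucʳ; length-replicate; length-map)
open import Data.Bool using (Bool; true; false)
open import Data.Fin using (Fin; zero; suc; toℕ; fromℕ<)
open import Data.Fin.Properties using (toℕ-injective; toℕ-fromℕ<; toℕ≤pred[n])
open import Data.Vec using (Vec; lookup; tabulate; []; _∷_)
open import Data.Vec.Properties using (lookup∘tabulate)
open import Data.Product using (Σ; _×_; _,_; proj₁; proj₂)
open import Function using (_∘_)
open import Relation.Binary.PropositionalEquality
open import Relation.Nullary using (does)
open import Relation.Nullary.Decidable using (dec-true; dec-false)

module _ {A : Set} where

  length-step : ∀ {x y : List A} → Step x y → length x ≤ suc (length y)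
  length-step (ins u v a) rewrite length-++-sucʳ u a v = m≤n⇒m≤1+n (n≤1+n _)
  length-step (del u v a) = ≤-reflexive (length-++-sucʳ u a v)
  length-step (sub u v a b) rewrite length-++-sucʳ u a v | length-++-sucʳ u b v = n≤1+n _

  length-edits : ∀ {m} {x y : List A} → EditsIn m x y → length x ≤ m + length y
  length-edits (none x) = ≤-refl
  length-edits (step st rest) = ≤-trans (length-step st) (s≤s (length-edits rest))

  edits-potential : (f g : List A → ℕ) →
    (∀ {x y} → Step x y → f x + g y ≤ suc (f y + g x)) →
    ∀ {m x y} → EditsIn m x y → f x + g y ≤ m + (f y + g x)
  edits-potential f g step-bound (none x) = ≤-refl
  edits-potential f g step-bound {suc m} {x} {z} (step {y = y} st rest) =
    +-cancelʳ-≤ (f y + g y) (f x + g z) (suc m + (f z + g x)) (begin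
      (f x + g z) + (f y + g y)           ≡⟨ regroup (f x) (g z) (f y) (g y) ⟩
      (f x + g y) + (f y + g z)           ≤⟨ +-mono-≤ (step-bound st) (edits-potential f g step-bound rest) ⟩
      suc (f y + g x) + (m + (f z + g y)) ≡⟨ cong suc (regroup′ (f y) (g x) m (f z) (g y)) ⟩
      (suc m + (f z + g x)) + (f y + g y) ∎)
    where
    open ≤-Reasoning
    regroup : ∀ a b c d → (a + b) + (c + d) ≡ (a + d) + (c + b)
    regroup = solve-∀
    regroup′ : ∀ a b c d e → (a + b) + (c + (d + e)) ≡ (c + (d + b)) + (a + e)
    regroup′ = solve-∀

  ∷-step : ∀ {x y : List A} a → Step x y → Step (a ∷ x) (a ∷ y)
  ∷-step a (ins u v b) = ins (a ∷ u) v b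
  ∷-step a (del u v b) = del (a ∷ u) v b
  ∷-step a (sub u v b c) = sub (a ∷ u) v b c

  ∷-edits : ∀ {m} {x y : List A} a → EditsIn m x y → EditsIn m (a ∷ x) (a ∷ y)
  ∷-edits a (none x) = none (a ∷ x)
  ∷-edits a (step st rest) = step (∷-step a st) (∷-edits a rest)

  delete-all : (x : List A) → EditsIn (length x) x []
  delete-all [] = none []
  delete-all (a ∷ x) = step (del [] x a) (delete-all x)

  overwrite : (c : A) (x : List A) (m : ℕ) → length x ≤ m → EditsIn m x (replicate m c)
  overwrite c [] zero _ = none []
  overwrite c [] (suc m) _ = step (ins [] [] c) (∷-edits c (overwrite c [] m z≤n))
  overwrite c (a ∷ x) (suc m) (s≤s |x|≤m) = step (sub [] x a c) (∷-edits c (overwrite c x m |x|≤m))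

  levDist-[] : ∀ (x : List A) {D} → IsLevDist x [] D → D ≡ length x
  levDist-[] x (edits , minimal) =
    ≤-antisym (minimal _ (delete-all x)) (subst (length x ≤_) (+-identityʳ _) (length-edits edits))

m≤1⇒m+o≤1+n+o : ∀ {m} n o → m ≤ 1 → m + o ≤ suc (n + o)
m≤1⇒m+o≤1+n+o {m} n o m≤1 = ≤-trans (+-monoˡ-≤ o m≤1) (s≤s (m≤n+m o n))

module Potential {A : Set} (one two : A → ℕ) (one+two≤1 : ∀ a → one a + two a ≤ 1) where

  ones twos : List A → ℕ
  ones = sum ∘ map one
  twos = sum ∘ map two

  one≤1 : ∀ a → one a ≤ 1
  one≤1 a = m+n≤o⇒m≤o (one a) (one+two≤1 a)

  two≤1 : ∀ a → two a ≤ 1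
  two≤1 a = m+n≤o⇒n≤o (one a) (one+two≤1 a)

  -- With Φₖ x = ones (take k x) − twos (drop k x), this says Φₖ x ≤ 1 + Φₖ y,
  -- with both sides moved so that no subtraction occurs.
  Φ≤1+Φ : ℕ → List A → List A → Set
  Φ≤1+Φ k x y = ones (take k x) + twos (drop k y) ≤ suc (ones (take k y) + twos (drop k x))

  Φ≤1+Φ-∷ : ∀ k {x y} a → Φ≤1+Φ k x y → Φ≤1+Φ (suc k) (a ∷ x) (a ∷ y)
  Φ≤1+Φ-∷ k {x} {y} a h = begin
    (one a + p) + t′       ≡⟨ +-assoc (one a) p t′ ⟩
    one a + (p + t′)       ≤⟨ +-monoʳ-≤ (one a) h ⟩
    one a + suc (p′ + t)   ≡⟨ +-suc (one a) (p′ + t) ⟩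
    suc (one a + (p′ + t)) ≡⟨ cong suc (+-assoc (one a) p′ t) ⟨
    suc ((one a + p′) + t) ∎
    where
    open ≤-Reasoning
    p = ones (take k x)
    t = twos (drop k x)
    p′ = ones (take k y)
    t′ = twos (drop k y)

  twos-insert : ∀ u v a → twos (u ++ a ∷ v) ≡ two a + twos (u ++ v)
  twos-insert [] v a = refl
  twos-insert (b ∷ u) v a = trans (cong (two b +_) (twos-insert u v a)) (x∙yz≈y∙xz (two b) (two a) _)

  cut-advance : ∀ k v → Σ ℕ λ o → Σ ℕ λ t → o + t ≤ 1 ×
    ones (take (suc k) v) ≡ ones (take k v) + o × twos (drop k v) ≡ twos (drop (suc k) v) + t
  cut-advance zero [] = 0 , 0 , z≤n , refl , refl
  cut-advance (suc k) [] = 0 , 0 , z≤n , refl , refl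
  cut-advance zero (a ∷ v) = one a , two a , one+two≤1 a , +-comm (one a) 0 , +-comm (two a) (twos v)
  cut-advance (suc k) (a ∷ v) with cut-advance k v
  ... | o , t , o+t≤1 , ones≡ , twos≡ =
    o , t , o+t≤1 , trans (cong (one a +_) ones≡) (sym (+-assoc (one a) _ o)) , twos≡

  Φ-insert : ∀ k u v a → Φ≤1+Φ k (u ++ v) (u ++ a ∷ v) × Φ≤1+Φ k (u ++ a ∷ v) (u ++ v)
  Φ-insert zero u v a rewrite twos-insert u v a =
    m≤1⇒m+o≤1+n+o 0 (twos (u ++ v)) (two≤1 a) , m≤1⇒m+o≤1+n+o (two a) (twos (u ++ v)) z≤n
  Φ-insert (suc k) (b ∷ u) v a =
    Φ≤1+Φ-∷ k b (proj₁ (Φ-insert k u v a)) , Φ≤1+Φ-∷ k b (proj₂ (Φ-insert k u v a))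
  Φ-insert (suc k) [] v a with cut-advance k v
  ... | o , t , o+t≤1 , ones≡ , twos≡ rewrite ones≡ | twos≡ = forward , backward
    where
    open ≤-Reasoning
    p = ones (take k v)
    r = twos (drop (suc k) v)
    regroup : ∀ p o r t → (p + o) + (r + t) ≡ (o + t) + (p + r)
    regroup = solve-∀
    forward : (p + o) + (r + t) ≤ suc ((one a + p) + r)
    forward = begin
      (p + o) + (r + t)     ≡⟨ regroup p o r t ⟩
      (o + t) + (p + r)     ≤⟨ m≤1⇒m+o≤1+n+o (one a) (p + r) o+t≤1 ⟩
      suc (one a + (p + r)) ≡⟨ cong suc (+-assoc (one a) p r) ⟨
      suc ((one a + p) + r) ∎
    backward : (one a + p) + r ≤ suc ((p + o) + (r + t))
    backward = begin
      (one a + p) + r         ≡⟨ +-assoc (one a) p r ⟩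
      one a + (p + r)         ≤⟨ m≤1⇒m+o≤1+n+o (o + t) (p + r) (one≤1 a) ⟩
      suc ((o + t) + (p + r)) ≡⟨ cong suc (regroup p o r t) ⟨
      suc ((p + o) + (r + t)) ∎

  Φ-substitute : ∀ k u v a b → Φ≤1+Φ k (u ++ a ∷ v) (u ++ b ∷ v)
  Φ-substitute zero u v a b rewrite twos-insert u v a | twos-insert u v b =
    m≤1⇒m+o≤1+n+o (two a) (twos (u ++ v)) (two≤1 b)
  Φ-substitute (suc k) (c ∷ u) v a b = Φ≤1+Φ-∷ k c (Φ-substitute k u v a b)
  Φ-substitute (suc k) [] v a b
    rewrite +-assoc (one a) (ones (take k v)) (twos (drop k v))
          | +-assoc (one b) (ones (take k v)) (twos (drop k v)) =
    m≤1⇒m+o≤1+n+o (one b) (ones (take k v) + twos (drop k v)) (one≤1 a)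

  Φ-step : ∀ k {x y} → Step x y → Φ≤1+Φ k x y
  Φ-step k (ins u v a) = proj₁ (Φ-insert k u v a)
  Φ-step k (del u v a) = proj₂ (Φ-insert k u v a)
  Φ-step k (sub u v a b) = Φ-substitute k u v a b

  Φ-edits : ∀ k {m x y} → EditsIn m x y →
    ones (take k x) + twos (drop k y) ≤ m + (ones (take k y) + twos (drop k x))
  Φ-edits k = edits-potential (ones ∘ take k) (twos ∘ drop k) (Φ-step k)

blank : Fin 3
blank = suc (suc zero)

isOne isBlank : Fin 3 → ℕ
isOne zero = 0
isOne (suc zero) = 1
isOne (suc (suc zero)) = 0
isBlank zero = 0
isBlank (suc zero) = 0
isBlank (suc (suc zero)) = 1

isOne+isBlank≤1 : ∀ a → isOne a + isBlank a ≤ 1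
isOne+isBlank≤1 zero = z≤n
isOne+isBlank≤1 (suc zero) = ≤-refl
isOne+isBlank≤1 (suc (suc zero)) = ≤-refl

open Potential isOne isBlank isOne+isBlank≤1

probe : ℕ → ℕ → List (Fin 3)
probe k m = replicate k zero ++ replicate m blank

ones-probe : ∀ k m → ones (take k (probe k m)) ≡ 0
ones-probe zero m = refl
ones-probe (suc k) m = ones-probe k m

twos-probe : ∀ k m → twos (drop k (probe k m)) ≡ m
twos-probe zero zero = refl
twos-probe zero (suc m) = cong suc (twos-probe zero m)
twos-probe (suc k) m = twos-probe k m

twos-embed : ∀ k s → twos (drop k (embed s)) ≡ 0
twos-embed zero [] = refl
twos-embed zero (false ∷ s) = twos-embed zero s
twos-embed zero (true ∷ s) = twos-embed zero s
twos-embed (suc k) [] = refl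
twos-embed (suc k) (b ∷ s) = twos-embed k s

edits-to-probe : ∀ s k m → k ≤ length s → length s ≤ k + m →
  EditsIn (ones (take k (embed s)) + m) (embed s) (probe k m)
edits-to-probe s zero m _ |s|≤m =
  overwrite blank (embed s) m (subst (_≤ m) (sym (length-map bit s)) |s|≤m)
edits-to-probe (false ∷ s) (suc k) m (s≤s k≤|s|) (s≤s |s|≤k+m) =
  ∷-edits zero (edits-to-probe s k m k≤|s| |s|≤k+m)
edits-to-probe (true ∷ s) (suc k) m (s≤s k≤|s|) (s≤s |s|≤k+m) =
  step (sub [] (embed s) (bit true) zero) (∷-edits zero (edits-to-probe s k m k≤|s| |s|≤k+m))

levDist-probe : ∀ s k m {D} → k ≤ length s → length s ≤ k + m →
  IsLevDist (embed s) (probe k m) D → D ≡ ones (take k (embed s)) + m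
levDist-probe s k m {D} k≤|s| |s|≤k+m (edits , minimal) =
  ≤-antisym (minimal _ (edits-to-probe s k m k≤|s| |s|≤k+m)) lower
  where
  lower : ones (take k (embed s)) + m ≤ D
  lower = subst₂ _≤_
    (cong (ones (take k (embed s)) +_) (twos-probe k m))
    (trans (cong₂ (λ p t → D + (p + t)) (ones-probe k m) (twos-embed k s)) (+-identityʳ D))
    (Φ-edits k edits)

bitsFromCounts : (ℕ → ℕ) → ℕ → List Bool
bitsFromCounts g zero = []
bitsFromCounts g (suc m) = does (g 0 <? g 1) ∷ bitsFromCounts (g ∘ suc) m

bit-increment : ∀ c b → does (c + 0 <? c + (isOne (bit b) + 0)) ≡ b
bit-increment c false = dec-false (c + 0 <? c + 0) (n≮n (c + 0))
bit-increment c true = dec-true (c + 0 <? c + 1) (+-monoʳ-< c ≤-refl)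

bitsFromCounts-correct : ∀ (g : ℕ → ℕ) c s →
  (∀ j → j ≤ length s → g j ≡ c + ones (take j (embed s))) → bitsFromCounts g (length s) ≡ s
bitsFromCounts-correct g c [] _ = refl
bitsFromCounts-correct g c (b ∷ s) g≡ = cong₂ _∷_
  (trans (cong₂ (λ p q → does (p <? q)) (g≡ 0 z≤n) (g≡ 1 (s≤s z≤n))) (bit-increment c b))
  (bitsFromCounts-correct (g ∘ suc) (c + isOne (bit b)) s λ j j≤|s| →
    trans (g≡ (suc j) (s≤s j≤|s|)) (sym (+-assoc c (isOne (bit b)) _)))

-- probe 0 n would be at distance n from every admissible s, so the query with
-- index 0 is [] instead, whose distance is |s|.
query : ℕ → ℕ → List (Fin 3)
query n zero = []
query n (suc j) = probe (suc j) (n ∸ suc j)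

queries : (n : ℕ) → Vec (List (Fin 3)) (suc n)
queries n = tabulate (query n ∘ toℕ)

zeros : List (Fin 3) → ℕ
zeros [] = 0
zeros (zero ∷ x) = suc (zeros x)
zeros (suc _ ∷ x) = zeros x

zeros-probe : ∀ k m → zeros (probe k m) ≡ k
zeros-probe zero zero = refl
zeros-probe zero (suc m) = zeros-probe zero m
zeros-probe (suc k) m = cong suc (zeros-probe k m)

zeros-query : ∀ n j → zeros (query n j) ≡ j
zeros-query n zero = refl
zeros-query n (suc j) = zeros-probe (suc j) (n ∸ suc j)

lookup-queries : ∀ n i → lookup (queries n) i ≡ query n (toℕ i)
lookup-queries n = lookup∘tabulate (query n ∘ toℕ)

queries-injective : ∀ n (i j : Fin (suc n)) → lookup (queries n) i ≡ lookup (queries n) j → i ≡ j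
queries-injective n i j qi≡qj = toℕ-injective (begin
  toℕ i                   ≡⟨ zeros-query n (toℕ i) ⟨
  zeros (query n (toℕ i)) ≡⟨ cong zeros (trans (sym (lookup-queries n i)) (trans qi≡qj (lookup-queries n j))) ⟩
  zeros (query n (toℕ j)) ≡⟨ zeros-query n (toℕ j) ⟩
  toℕ j                   ∎)
  where open ≡-Reasoning

query-length : ∀ n j → j ≤ n → length (query n j) ≤ n
query-length n zero _ = z≤n
query-length n (suc j) j<n = ≤-reflexive (begin
  length (probe (suc j) (n ∸ suc j))
    ≡⟨ length-++ (replicate (suc j) zero) ⟩
  length (replicate (suc j) zero) + length (replicate (n ∸ suc j) blank)
    ≡⟨ cong₂ _+_ (length-replicate (suc j)) (length-replicate (n ∸ suc j)) ⟩
  suc j + (n ∸ suc j)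
    ≡⟨ m+[n∸m]≡n j<n ⟩
  n ∎)
  where open ≡-Reasoning

queries-length : ∀ n (i : Fin (suc n)) → length (lookup (queries n) i) ≤ n
queries-length n i rewrite lookup-queries n i = query-length n (toℕ i) (toℕ≤pred[n] i)

valueAt : ∀ {m} → Vec ℕ m → ℕ → ℕ
valueAt [] _ = 0
valueAt (x ∷ v) zero = x
valueAt (x ∷ v) (suc j) = valueAt v j

valueAt-lookup : ∀ {m} (v : Vec ℕ m) j (j<m : j < m) → valueAt v j ≡ lookup v (fromℕ< j<m)
valueAt-lookup (x ∷ v) zero _ = refl
valueAt-lookup (x ∷ v) (suc j) (s≤s j<m) = valueAt-lookup v j j<m

onesCounts : (n : ℕ) → Vec ℕ (suc n) → ℕ → ℕ
onesCounts n d zero = 0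
onesCounts n d (suc j) = valueAt d (suc j) ∸ (n ∸ suc j)

decode : (n : ℕ) → Vec ℕ (suc n) → List Bool
decode n d = bitsFromCounts (onesCounts n d) (valueAt d 0)

decode-correct : ∀ n s → length s ≤ n → (d : Vec ℕ (suc n)) →
  ((i : Fin (suc n)) → IsLevDist (embed s) (lookup (queries n) i) (lookup d i)) →
  decode n d ≡ s
decode-correct n s |s|≤n d levDist = trans
  (cong (bitsFromCounts (onesCounts n d)) (trans (levDist-[] (embed s) (levDistAt 0 z≤n)) (length-map bit s)))
  (bitsFromCounts-correct (onesCounts n d) 0 s onesCounts≡)
  where
  levDistAt : ∀ j → j ≤ n → IsLevDist (embed s) (query n j) (valueAt d j)
  levDistAt j j≤n = subst₂ (IsLevDist (embed s))
    (trans (lookup-queries n (fromℕ< (s≤s j≤n))) (cong (query n) (toℕ-fromℕ< (s≤s j≤n))))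
    (sym (valueAt-lookup d j (s≤s j≤n)))
    (levDist (fromℕ< (s≤s j≤n)))
  onesCounts≡ : ∀ j → j ≤ length s → onesCounts n d j ≡ ones (take j (embed s))
  onesCounts≡ zero _ = refl
  onesCounts≡ (suc j) j<|s| = begin
    valueAt d (suc j) ∸ (n ∸ suc j)
      ≡⟨ cong (_∸ (n ∸ suc j)) (levDist-probe s (suc j) (n ∸ suc j) j<|s| |s|≤1+j+[n∸1+j]
           (levDistAt (suc j) j<n)) ⟩
    (ones (take (suc j) (embed s)) + (n ∸ suc j)) ∸ (n ∸ suc j)
      ≡⟨ m+n∸n≡m _ (n ∸ suc j) ⟩
    ones (take (suc j) (embed s)) ∎
    where
    open ≡-Reasoning
    j<n = ≤-trans j<|s| |s|≤n
    |s|≤1+j+[n∸1+j] = ≤-trans |s|≤n (≤-reflexive (sym (m+[n∸m]≡n j<n)))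

mainTheorem6 : (n : ℕ) → 1 ≤ n →
    Σ (Vec (List (Fin 3)) (suc n)) λ Q →
      ((i j : Fin (suc n)) → lookup Q i ≡ lookup Q j → i ≡ j) ×
      ((i : Fin (suc n)) → length (lookup Q i) ≤ n) ×
      Σ (Vec ℕ (suc n) → List Bool) λ decode →
        (s : List Bool) → length s ≤ n →
        (d : Vec ℕ (suc n)) →
        ((i : Fin (suc n)) → IsLevDist (embed s) (lookup Q i) (lookup d i)) →
        decode d ≡ s
mainTheorem6 n _ =
  queries n , queries-injective n , queries-length n , decode n , decode-correct n
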